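{- Let $x\in W$ with $\mathrm{lev}(x)>0$, let $\alpha$ be a double affine root with finite part $\nu$, and let $\beta=\gamma+p\delta+q\pi$ be a double affine root. Write $-s_\alpha(\beta)=\gamma'+p'\delta+q'\pi$. Then $\beta\in L_{x,\alpha}$ if and only if $(p,q)\in\Gamma_{x,\gamma}$ and $(p',q')\in\Gamma_{x,\gamma'}$.
   Context: Setting: $\Phi_{\mathrm{fin}}$ irreducible simply laced finite root system, pairing $\langle\,,\rangle$ with $\langle\nu,\nu\rangle=2$, root lattice $Q$, weight lattice $P$, Weyl group $W_{\mathrm{fin}}$. Affine roots $\nu+r\delta$ ($\nu\in\Phi_{\mathrm{fin}},r\in\mathbb{Z}$), positive iff $r>0$ or ($r=0$ and $\nu>0$). $X=P\oplus\mathbb{Z}\delta\oplus\mathbb{Z}\Lambda_0$, level of $\mu+m\delta+l\Lambda_0$ is $l$; $\langle\mu+m\delta+l\Lambda_0,\nu+r\delta\rangle=\langle\mu,\nu\rangle+lr$. $W_{\mathrm{aff}}=\{Y^\lambda w:\lambda\in Q, w\in W_{\mathrm{fin}}\}$ acts on affine roots by $Y^\lambda w(\nu+r\delta)=w(\nu)+(r-\langle\lambda,w(\nu)\rangle)\delta$; $s_{\nu+r\delta}=Y^{ -r\nu}s_\nu$. Tits cone $\mathcal T=\{m\delta\}\cup\{\text{positive level elements of }X\}$; $W=\{X^\zeta\tilde w:\zeta\in\mathcal T,\tilde w\in W_{\mathrm{aff}}\}\subset X\rtimes W_{\mathrm{aff}}$, $\mathrm{lev}(X^\zeta\tilde w)=\mathrm{lev}(\zeta)$.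 Double affine roots $\tilde\alpha+j\pi$ with $\tilde\alpha$ affine root, $j\in\mathbb{Z}$; positive if $\tilde\alpha>0,j\ge0$ or $\tilde\alpha<0,j>0$, negative otherwise. The finite part of $\nu+r\delta+j\pi$ is $\nu$. $s_{\tilde\alpha+j\pi}=X^{ -j\tilde\alpha}s_{\tilde\alpha}$, and $X\rtimes W_{\mathrm{aff}}$ acts on double affine roots by $X^\zeta\tilde w(\tilde\alpha+j\pi)=\tilde w(\tilde\alpha)+(j-\langle\zeta,\tilde w(\tilde\alpha)\rangle)\pi$. For $x\in W$ and $\nu\in\Phi_{\mathrm{fin}}$, $\Gamma_{x,\nu}=\{(r,j)\in\mathbb{Z}^2: \nu+r\delta+j\pi \text{ is positive and } x^{ -1}(\nu+r\delta+j\pi)\text{ is negative}\}$. For $x\in W$ and a double affine root $\alpha$, $L_{x,\alpha}=\{\beta \text{ positive double affine root}: x^{ -1}(\beta)\text{ negative}, s_\alpha(\beta)\text{ negative}, x^{ -1}s_\alpha(\beta)\text{ positive}\}$. -}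

module Defs where

open import Data.Nat using (ℕ; zero; suc) renaming (_≤_ to _≤ℕ_)
open import Data.Integer using (ℤ; +_; 0ℤ; -1ℤ; 1ℤ; _+_; _-_; _*_; -_; _<_; _≤_)
open import Data.Fin using (Fin; zero; suc)
import Data.Fin as F
open import Data.List using (List; []; _∷_; reverse)
open import Data.Bool using (Bool; true; false)
open import Data.Product using (Σ; ∃; ∃₂; _×_; _,_)
open import Data.Sum using (_⊎_)
open import Relation.Nullary using (¬_; yes; no)
open import Relation.Binary.PropositionalEquality using (_≡_)

Vecℤ : ℕ → Set
Vecℤ n = Fin n → ℤ

sumℤ : ∀ {n} → (Fin n → ℤ) → ℤ
sumℤ {zero} f = 0ℤ
sumℤ {suc n} f = f zero + sumℤ (λ i → f (suc i))

dot : ∀ {n} → Vecℤ n → Vecℤ n → ℤ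
dot u v = sumℤ (λ i → u i * v i)

bil : ∀ {n} → (Fin n → Fin n → ℤ) → Vecℤ n → Vecℤ n → ℤ
bil A u v = sumℤ (λ i → u i * sumℤ (λ j → A i j * v j))

-- Cartan matrix of an irreducible simply laced finite root system (type ADE):
-- symmetric, 2 on the diagonal, 0/-1 off the diagonal, positive definite
-- (finite type), connected Dynkin diagram (irreducible), rank ≥ 1.
record SimplyLacedCartan (n : ℕ) : Set where
  field
    A           : Fin n → Fin n → ℤ
    nonempty    : 1 ≤ℕ n
    symmetric   : ∀ i j → A i j ≡ A j i
    diagonal    : ∀ i → A i i ≡ + 2
    offDiagonal : ∀ i j → ¬ i ≡ j → (A i j ≡ 0ℤ ⊎ A i j ≡ -1ℤ)
    posDef      : ∀ (v : Vecℤ n) → (∃ λ i → ¬ v i ≡ 0ℤ) → 0ℤ < bil A v v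
    connected   : ∀ (S : Fin n → Bool) →
                  (∀ i j → S i ≡ true → S j ≡ false → A i j ≡ 0ℤ) →
                  (∀ i → S i ≡ true) ⊎ (∀ i → S i ≡ false)

module Setup {n : ℕ} (C : SimplyLacedCartan n) where
  open SimplyLacedCartan C

  -- Root lattice Q in simple-root coordinates; weight lattice P in
  -- fundamental-weight coordinates.
  Q : Set
  Q = Vecℤ n
  P : Set
  P = Vecℤ n

  ⟪_,_⟫ : Q → Q → ℤ
  ⟪ u , v ⟫ = bil A u v

  -- embedding Q ⊂ P  (α_i = Σ_j A_ij ϖ_j); then ⟨ι u , v⟩ = ⟪ u , v ⟫
  ι : Q → P
  ι u j = sumℤ (λ i → u i * A i j)

  _≈_ : Vecℤ n → Vecℤ n → Set
  u ≈ v = ∀ i → u i ≡ v i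

  simple : Fin n → Q
  simple i j with i F.≟ j
  ... | yes _ = 1ℤ
  ... | no _  = 0ℤ

  refl' : Q → Q → Q
  refl' ν v i = v i - ⟪ v , ν ⟫ * ν i

  -- elements of W_fin as words in simple reflections: i₁ ∷ … ∷ i_k ↦ s_{i₁}⋯s_{i_k}
  WordFin : Set
  WordFin = List (Fin n)

  actFin : WordFin → Q → Q
  actFin [] v = v
  actFin (i ∷ w) v = refl' (simple i) (actFin w v)

  IsRoot : Q → Set
  IsRoot v = ∃₂ λ (w : WordFin) (i : Fin n) → v ≈ actFin w (simple i)

  PosFin : Q → Set
  PosFin v = ∀ i → 0ℤ ≤ v i

  -- affine roots ν + rδ  as (ν , r)
  Aff : Set
  Aff = Q × ℤ

  PosAff : Aff → Set
  PosAff (ν , r) = (0ℤ < r) ⊎ (r ≡ 0ℤ × PosFin ν)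

  -- double affine roots ν + rδ + jπ  as (ν , r , j)
  DAR : Set
  DAR = Q × ℤ × ℤ

  PosD : DAR → Set
  PosD (ν , r , j) = (PosAff (ν , r) × 0ℤ ≤ j) ⊎ (¬ PosAff (ν , r) × 0ℤ < j)

  NegD : DAR → Set
  NegD β = ¬ PosD β

  negD : DAR → DAR
  negD (ν , r , j) = (λ i → - ν i) , - r , - j

  -- X = P ⊕ ℤδ ⊕ ℤΛ₀ :  μ + mδ + lΛ₀  as  mkX μ m l
  record X : Set where
    constructor mkX
    field
      μ   : P
      m   : ℤ
      lev : ℤ

  pairX : X → Aff → ℤ
  pairX (mkX μ m l) (ν , r) = dot μ ν + l * r

  negX : X → X
  negX (mkX μ m l) = mkX (λ i → - μ i) (- m) (- l)

  zeroX : X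
  zeroX = mkX (λ _ → 0ℤ) 0ℤ 0ℤ

  TitsCone : X → Set
  TitsCone (mkX μ m l) = ((∀ i → μ i ≡ 0ℤ) × l ≡ 0ℤ) ⊎ (0ℤ < l)

  -- elements X^ζ Y^λ w of X ⋊ W_aff
  record XW : Set where
    constructor xw
    field
      ζ  : X
      λY : Q
      w  : WordFin

  actAff : Q → WordFin → Aff → Aff
  actAff lam w (ν , r) = actFin w ν , r - ⟪ lam , actFin w ν ⟫

  actD : XW → DAR → DAR
  actD (xw ζ lam w) (ν , r , j) with actAff lam w (ν , r)
  ... | (ν' , r') = ν' , r' , j - pairX ζ (ν' , r')

  -- x⁻¹ = w⁻¹ Y^{-λ} X^{-ζ}  for x = X^ζ Y^λ w  (w⁻¹ = reversed word)
  actInv : XW → DAR → DAR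
  actInv (xw ζ lam w) β =
    actD (xw zeroX (λ _ → 0ℤ) (reverse w))
      (actD (xw zeroX (λ i → - lam i) [])
        (actD (xw (negX ζ) (λ _ → 0ℤ) []) β))

  record W : Set where
    field
      elt  : XW
      tits : TitsCone (XW.ζ elt)

  levW : W → ℤ
  levW x = X.lev (XW.ζ (W.elt x))

  reflD : Q → DAR → DAR
  reflD ν (γ , p , q) = refl' ν γ , p , q

  -- s_{ν+rδ+jπ} = X^{-j(ν+rδ)} Y^{-rν} s_ν
  sD : DAR → DAR → DAR
  sD (ν , r , j) β =
    actD (xw (mkX (λ i → - (j * ι ν i)) (- (j * r)) 0ℤ) (λ _ → 0ℤ) [])
      (actD (xw zeroX (λ i → - (r * ν i)) []) (reflD ν β))

  Γ : W → Q → ℤ × ℤ → Set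
  Γ x ν (r , j) = PosD (ν , r , j) × NegD (actInv (W.elt x) (ν , r , j))

  L : W → DAR → DAR → Set
  L x α β = PosD β × NegD (actInv (W.elt x) β)
            × NegD (sD α β) × PosD (actInv (W.elt x) (sD α β))

-- A double affine root β = ν + rδ + jπ with ⟨ν,ν⟩ = 2 is negative exactly when -β is
-- positive.  This reduces to the affine root ν + rδ being positive or negative but not
-- both, which is clear for r ≠ 0; for r = 0 it says that ν has coordinates of constant
-- sign.  Writing ν = ν⁺ - ν⁻ with disjointly supported nonnegative parts, the Cartan
-- form is even, positive definite and nonpositive off the diagonal, so a vector of mixed
-- signs has ⟨ν,ν⟩ ≥ 2 + 2.  Since x⁻¹ and s_α commute with negation and keep finite parts
-- of norm 2, the conditions "s_α β negative, x⁻¹ s_α β positive" in L_{x,α} say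
-- precisely that -s_α β lies in Γ_{x,γ'}.
module Submission where

open import Data.Fin using (Fin; zero; suc)
import Data.Fin.Properties as Fin
open import Data.Integer
  using (ℤ; +_; +[1+_]; -[1+_]; 0ℤ; 1ℤ; -1ℤ; _+_; _-_; _*_; -_; _≤_; _<_; +≤+; +<+; ∣_∣)
open import Data.Integer.Properties
  using ( +-*-semiring; +-mono-≤; +-identityʳ; +-identityˡ; *-identityʳ; *-zeroʳ; *-comm
        ; -1*i≡-i; pos-*; ≤-reflexive; ≤-antisym; _≤?_; <-cmp; <-asym; <-irrefl; ≰⇒>; <⇒≤; ≤⇒≯
        ; neg-mono-≤; neg-cancel-≤; neg-mono-<; neg-cancel-<; neg-involutive )
open import Data.Integer.Tactic.RingSolver using (solve-∀)
open import Algebra.Properties.Semiring.Sum +-*-semiring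
  using (sum; sum-cong-≗; ∑-distrib-+; ∑-comm; *-distribˡ-sum; sum-replicate-zero)
open import Data.List using ([]; _∷_; reverse)
open import Data.Nat using (ℕ; zero; suc; z≤n; s≤s)
import Data.Nat as ℕ
import Data.Nat.Properties as ℕ
open import Data.Product using (∃; _,_; _×_; proj₁; proj₂)
open import Data.Sum using (_⊎_; inj₁; inj₂)
open import Function using (_∘_)
open import Function.Bundles using (_⇔_; mk⇔; Equivalence)
open import Relation.Binary.Definitions using (tri<; tri≈; tri>)
open import Relation.Binary.PropositionalEquality
open import Relation.Nullary using (¬_; yes; no; contradiction)

open import Defs

sumℤ≡sum : ∀ {n} (f : Fin n → ℤ) → sumℤ f ≡ sum f
sumℤ≡sum {zero} f = refl
sumℤ≡sum {suc n} f = cong (λ s → f zero + s) (sumℤ≡sum (λ i → f (suc i)))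

sumℤ-cong : ∀ {n} {f g : Fin n → ℤ} → (∀ i → f i ≡ g i) → sumℤ f ≡ sumℤ g
sumℤ-cong {f = f} {g} f≗g = trans (sumℤ≡sum f) (trans (sum-cong-≗ {x = f} {g} f≗g) (sym (sumℤ≡sum g)))

sumℤ-distrib-+ : ∀ {n} (f g : Fin n → ℤ) → sumℤ (λ i → f i + g i) ≡ sumℤ f + sumℤ g
sumℤ-distrib-+ f g =
  trans (sumℤ≡sum (λ i → f i + g i)) (trans (∑-distrib-+ f g) (sym (cong₂ _+_ (sumℤ≡sum f) (sumℤ≡sum g))))

*-distribˡ-sumℤ : ∀ {n} c (f : Fin n → ℤ) → c * sumℤ f ≡ sumℤ (λ i → c * f i)
*-distribˡ-sumℤ c f =
  trans (cong (c *_) (sumℤ≡sum f)) (trans (*-distribˡ-sum c f) (sym (sumℤ≡sum (λ i → c * f i))))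

sumℤ-comm : ∀ {m n} (f : Fin m → Fin n → ℤ) →
  sumℤ (λ i → sumℤ (f i)) ≡ sumℤ (λ j → sumℤ (λ i → f i j))
sumℤ-comm f = begin
  sumℤ (λ i → sumℤ (f i))           ≡⟨ sumℤ≡sum (λ i → sumℤ (f i)) ⟩
  sum (λ i → sumℤ (f i))            ≡⟨ sum-cong-≗ {x = λ i → sumℤ (f i)} (λ i → sumℤ≡sum (f i)) ⟩
  sum (λ i → sum (f i))             ≡⟨ ∑-comm f ⟩
  sum (λ j → sum (λ i → f i j))     ≡⟨ sum-cong-≗ {x = λ j → sumℤ (λ i → f i j)} (λ j → sumℤ≡sum (λ i → f i j)) ⟨
  sum (λ j → sumℤ (λ i → f i j))    ≡⟨ sumℤ≡sum (λ j → sumℤ (λ i → f i j)) ⟨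
  sumℤ (λ j → sumℤ (λ i → f i j))   ∎
  where open ≡-Reasoning

sumℤ-zero : ∀ n → sumℤ {n} (λ _ → 0ℤ) ≡ 0ℤ
sumℤ-zero n = trans (sumℤ≡sum {n} (λ _ → 0ℤ)) (sum-replicate-zero n)

sumℤ-nonpos : ∀ {n} (f : Fin n → ℤ) → (∀ i → f i ≤ 0ℤ) → sumℤ f ≤ 0ℤ
sumℤ-nonpos {zero} f f≤0 = +≤+ z≤n
sumℤ-nonpos {suc n} f f≤0 = +-mono-≤ (f≤0 zero) (sumℤ-nonpos (λ i → f (suc i)) (λ i → f≤0 (suc i)))

sumℤ-indicator : ∀ {n} (i : Fin n) (δ g : Fin n → ℤ) →
  δ i ≡ 1ℤ → (∀ j → ¬ i ≡ j → δ j ≡ 0ℤ) → sumℤ (λ j → g j * δ j) ≡ g i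
sumℤ-indicator {suc n} zero δ g δi≡1 δj≡0 = begin
  g zero * δ zero + sumℤ (λ j → g (suc j) * δ (suc j))  ≡⟨ cong₂ _+_ (cong (g zero *_) δi≡1) (sumℤ-cong vanish) ⟩
  g zero * 1ℤ + sumℤ {n} (λ _ → 0ℤ)                     ≡⟨ cong₂ _+_ (*-identityʳ (g zero)) (sumℤ-zero n) ⟩
  g zero + 0ℤ                                           ≡⟨ +-identityʳ (g zero) ⟩
  g zero                                                ∎
  where
  open ≡-Reasoning
  vanish : ∀ j → g (suc j) * δ (suc j) ≡ 0ℤ
  vanish j = trans (cong (g (suc j) *_) (δj≡0 (suc j) (λ ()))) (*-zeroʳ (g (suc j)))
sumℤ-indicator {suc n} (suc i) δ g δi≡1 δj≡0 = begin
  g zero * δ zero + sumℤ (λ j → g (suc j) * δ (suc j))  ≡⟨ cong (_+ sumℤ (λ j → g (suc j) * δ (suc j))) g₀δ₀≡0 ⟩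
  0ℤ + sumℤ (λ j → g (suc j) * δ (suc j))               ≡⟨ +-identityˡ _ ⟩
  sumℤ (λ j → g (suc j) * δ (suc j))                    ≡⟨ sumℤ-indicator i (δ ∘ suc) (g ∘ suc) δi≡1 δj≡0′ ⟩
  g (suc i)                                             ∎
  where
  open ≡-Reasoning
  g₀δ₀≡0 : g zero * δ zero ≡ 0ℤ
  g₀δ₀≡0 = trans (cong (g zero *_) (δj≡0 zero (λ ()))) (*-zeroʳ (g zero))
  δj≡0′ : ∀ j → ¬ i ≡ j → δ (suc j) ≡ 0ℤ
  δj≡0′ j i≢j = δj≡0 (suc j) (i≢j ∘ Fin.suc-injective)

positivePart : ℤ → ℕ
positivePart (+ m)    = m
positivePart -[1+ m ] = 0

negativePart : ℤ → ℕ
negativePart (+ m)    = 0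
negativePart -[1+ m ] = suc m

positivePart-negativePart : ∀ x → x ≡ + positivePart x - + negativePart x
positivePart-negativePart (+ m)    = sym (+-identityʳ (+ m))
positivePart-negativePart -[1+ m ] = refl

positivePart*negativePart≡0 : ∀ x → positivePart x ℕ.* negativePart x ≡ 0
positivePart*negativePart≡0 (+ m)    = ℕ.*-zeroʳ m
positivePart*negativePart≡0 -[1+ m ] = refl

negativePart≢0 : ∀ {x} → ¬ 0ℤ ≤ x → ¬ negativePart x ≡ 0
negativePart≢0 {+ m}    x≱0 _  = x≱0 (+≤+ z≤n)
negativePart≢0 { -[1+ m ]} _ ()

positivePart≢0 : ∀ {x} → ¬ 0ℤ ≤ - x → ¬ positivePart x ≡ 0
positivePart≢0 {+ zero}    -x≱0 _  = -x≱0 (+≤+ z≤n)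
positivePart≢0 {+[1+ m ]}  _    ()
positivePart≢0 { -[1+ m ]} -x≱0 _  = -x≱0 (+≤+ z≤n)

positive⇒two≤double : ∀ {k} → 0ℤ < k + k → + 2 ≤ k + k
positive⇒two≤double {+ zero}    (+<+ ())
positive⇒two≤double {+[1+ m ]}  _ = +-mono-≤ {+ 1} {+[1+ m ]} (+≤+ (s≤s z≤n)) (+≤+ (s≤s z≤n))
positive⇒two≤double { -[1+ m ]} ()

module BilinearForm {n : ℕ} (A : Fin n → Fin n → ℤ) where

  bil-cong : ∀ {u u′ v v′ : Fin n → ℤ} → (∀ i → u i ≡ u′ i) → (∀ i → v i ≡ v′ i) →
             bil A u v ≡ bil A u′ v′
  bil-cong u≗u′ v≗v′ =
    sumℤ-cong (λ i → cong₂ _*_ (u≗u′ i) (sumℤ-cong (λ j → cong (A i j *_) (v≗v′ j))))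

  bil-linearˡ : ∀ a b (u w v : Fin n → ℤ) →
    bil A (λ i → a * u i + b * w i) v ≡ a * bil A u v + b * bil A w v
  bil-linearˡ a b u w v = begin
    sumℤ (λ i → (a * u i + b * w i) * Av i)        ≡⟨ sumℤ-cong (λ i → distrib a b (u i) (w i) (Av i)) ⟩
    sumℤ (λ i → a * uAv i + b * wAv i)             ≡⟨ sumℤ-distrib-+ (λ i → a * uAv i) (λ i → b * wAv i) ⟩
    sumℤ (λ i → a * uAv i) + sumℤ (λ i → b * wAv i) ≡⟨ cong₂ _+_ (*-distribˡ-sumℤ a uAv) (*-distribˡ-sumℤ b wAv) ⟨
    a * bil A u v + b * bil A w v                  ∎
    where
    open ≡-Reasoning
    Av uAv wAv : Fin n → ℤ
    Av i = sumℤ (λ j → A i j * v j)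
    uAv i = u i * Av i
    wAv i = w i * Av i
    distrib : ∀ a b x y z → (a * x + b * y) * z ≡ a * (x * z) + b * (y * z)
    distrib = solve-∀

  bil-sym : (∀ i j → A i j ≡ A j i) → ∀ u v → bil A u v ≡ bil A v u
  bil-sym A-sym u v = begin
    sumℤ (λ i → u i * sumℤ (λ j → A i j * v j))      ≡⟨ sumℤ-cong (λ i → *-distribˡ-sumℤ (u i) (λ j → A i j * v j)) ⟩
    sumℤ (λ i → sumℤ (λ j → u i * (A i j * v j)))    ≡⟨ sumℤ-comm (λ i j → u i * (A i j * v j)) ⟩
    sumℤ (λ j → sumℤ (λ i → u i * (A i j * v j)))    ≡⟨ sumℤ-cong (λ j → sumℤ-cong (λ i → swap j i)) ⟩
    sumℤ (λ j → sumℤ (λ i → v j * (A j i * u i)))    ≡⟨ sumℤ-cong (λ j → *-distribˡ-sumℤ (v j) (λ i → A j i * u i)) ⟨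
    sumℤ (λ j → v j * sumℤ (λ i → A j i * u i))      ∎
    where
    open ≡-Reasoning
    swap : ∀ j i → u i * (A i j * v j) ≡ v j * (A j i * u i)
    swap j i = trans (reorder (u i) (A i j) (v j)) (cong (λ a → v j * (a * u i)) (A-sym i j))
      where
      reorder : ∀ x a y → x * (a * y) ≡ y * (a * x)
      reorder = solve-∀

  bil-combination : (∀ i j → A i j ≡ A j i) → ∀ a b (u w : Fin n → ℤ) →
    let s = λ i → a * u i + b * w i in
    bil A s s ≡ a * a * bil A u u + + 2 * a * b * bil A u w + b * b * bil A w w
  bil-combination A-sym a b u w = begin
    bil A s s                                        ≡⟨ bil-linearˡ a b u w s ⟩
    a * bil A u s + b * bil A w s                    ≡⟨ cong₂ (λ x y → a * x + b * y) (expand u) (expand w) ⟩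
    a * (a * bil A u u + b * bil A w u) + b * (a * bil A u w + b * bil A w w)
      ≡⟨ cong (λ x → a * (a * bil A u u + b * x) + b * (a * bil A u w + b * bil A w w)) (bil-sym A-sym w u) ⟩
    a * (a * bil A u u + b * bil A u w) + b * (a * bil A u w + b * bil A w w)
      ≡⟨ collect a b (bil A u u) (bil A u w) (bil A w w) ⟩
    a * a * bil A u u + + 2 * a * b * bil A u w + b * b * bil A w w ∎
    where
    open ≡-Reasoning
    s : Fin n → ℤ
    s i = a * u i + b * w i
    expand : ∀ t → bil A t s ≡ a * bil A u t + b * bil A w t
    expand t = trans (bil-sym A-sym t s) (bil-linearˡ a b u w t)
    collect : ∀ a b x y z → a * (a * x + b * y) + b * (a * y + b * z) ≡ a * a * x + + 2 * a * b * y + b * b * z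
    collect = solve-∀

bil-self-even : ∀ {n} (A : Fin n → Fin n → ℤ) → (∀ i j → A i j ≡ A j i) →
  (∀ i → ∃ λ d → A i i ≡ d + d) → ∀ u → ∃ λ k → bil A u u ≡ k + k
bil-self-even {zero} A A-sym A-even u = 0ℤ , refl
bil-self-even {suc n} A A-sym A-even u
  with A-even zero | bil-self-even (λ i j → A (suc i) (suc j)) (λ i j → A-sym (suc i) (suc j))
                                   (λ i → A-even (suc i)) (u ∘ suc)
... | d , A₀₀≡d+d | k , tail≡k+k = d * u₀ * u₀ + u₀ * S + k , (begin
  u₀ * (A zero zero * u₀ + S) + sumℤ (λ i → u (suc i) * (A (suc i) zero * u₀ + T i))
    ≡⟨ cong₂ (λ a t → u₀ * (a * u₀ + S) + t) A₀₀≡d+d (sumℤ-cong split) ⟩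
  head + sumℤ (λ i → cross i + rest i)       ≡⟨ cong (λ t → head + t) (sumℤ-distrib-+ cross rest) ⟩
  head + (sumℤ cross + sumℤ rest)            ≡⟨ cong₂ (λ x y → head + (x + y)) (sym (*-distribˡ-sumℤ u₀ Su)) tail≡k+k ⟩
  head + (u₀ * S + (k + k))                  ≡⟨ collect d u₀ S k ⟩
  (d * u₀ * u₀ + u₀ * S + k) + (d * u₀ * u₀ + u₀ * S + k) ∎)
  where
  open ≡-Reasoning
  u₀ : ℤ
  u₀ = u zero
  Su T cross rest : Fin n → ℤ
  Su j = A zero (suc j) * u (suc j)
  T i = sumℤ (λ j → A (suc i) (suc j) * u (suc j))
  cross i = u₀ * Su i
  rest i = u (suc i) * T i
  S head : ℤ
  S = sumℤ Su
  head = u₀ * ((d + d) * u₀ + S)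
  split : ∀ i → u (suc i) * (A (suc i) zero * u₀ + T i) ≡ cross i + rest i
  split i = trans (cong (λ a → u (suc i) * (a * u₀ + T i)) (A-sym (suc i) zero))
                  (reorder (u (suc i)) (A zero (suc i)) u₀ (T i))
    where
    reorder : ∀ x a y t → x * (a * y + t) ≡ y * (a * x) + x * t
    reorder = solve-∀
  collect : ∀ d x s k → x * ((d + d) * x + s) + (x * s + (k + k))
                      ≡ (d * x * x + x * s + k) + (d * x * x + x * s + k)
  collect = solve-∀

module RootSystem {n : ℕ} (C : SimplyLacedCartan n) where
  open SimplyLacedCartan C
  open Setup C
  open BilinearForm A

  norm² : Q → ℤ
  norm² v = ⟪ v , v ⟫

  ⟪⟫-sym : ∀ u v → ⟪ u , v ⟫ ≡ ⟪ v , u ⟫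
  ⟪⟫-sym = bil-sym symmetric

  norm²-cong : ∀ {u v} → u ≈ v → norm² u ≡ norm² v
  norm²-cong u≈v = bil-cong u≈v u≈v

  norm²-simple : ∀ i → norm² (simple i) ≡ + 2
  norm²-simple i = begin
    sumℤ (λ k → simple i k * sumℤ (λ j → A k j * simple i j))
      ≡⟨ sumℤ-cong (λ k → *-comm (simple i k) _) ⟩
    sumℤ (λ k → sumℤ (λ j → A k j * simple i j) * simple i k)
      ≡⟨ sumℤ-cong (λ k → cong (_* simple i k) (indicator (A k))) ⟩
    sumℤ (λ k → A k i * simple i k)  ≡⟨ indicator (λ k → A k i) ⟩
    A i i                            ≡⟨ diagonal i ⟩
    + 2                              ∎
    where
    open ≡-Reasoning
    simple-self : simple i i ≡ 1ℤ
    simple-self with i Fin.≟ i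
    ... | yes _  = refl
    ... | no i≢i = contradiction refl i≢i
    simple-other : ∀ j → ¬ i ≡ j → simple i j ≡ 0ℤ
    simple-other j i≢j with i Fin.≟ j
    ... | yes i≡j = contradiction i≡j i≢j
    ... | no _    = refl
    indicator : ∀ g → sumℤ (λ j → g j * simple i j) ≡ g i
    indicator g = sumℤ-indicator i (simple i) g simple-self simple-other

  norm²-reflection : ∀ ν v → norm² ν ≡ + 2 → norm² (refl' ν v) ≡ norm² v
  norm²-reflection ν v ‖ν‖²≡2 = begin
    norm² (refl' ν v)                                    ≡⟨ norm²-cong as-combination ⟩
    norm² (λ i → 1ℤ * v i + - c * ν i)                   ≡⟨ bil-combination symmetric 1ℤ (- c) v ν ⟩
    1ℤ * 1ℤ * norm² v + + 2 * 1ℤ * - c * ⟪ v , ν ⟫ + - c * - c * norm² ν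
      ≡⟨ cong (λ x → 1ℤ * 1ℤ * norm² v + + 2 * 1ℤ * - c * c + - c * - c * x) ‖ν‖²≡2 ⟩
    1ℤ * 1ℤ * norm² v + + 2 * 1ℤ * - c * c + - c * - c * + 2 ≡⟨ cancel (norm² v) c ⟩
    norm² v                                              ∎
    where
    open ≡-Reasoning
    c : ℤ
    c = ⟪ v , ν ⟫
    as-combination : refl' ν v ≈ (λ i → 1ℤ * v i + - c * ν i)
    as-combination i = rewrite-difference (v i) c (ν i)
      where
      rewrite-difference : ∀ x c y → x - c * y ≡ 1ℤ * x + - c * y
      rewrite-difference = solve-∀
    cancel : ∀ x c → 1ℤ * 1ℤ * x + + 2 * 1ℤ * - c * c + - c * - c * + 2 ≡ x
    cancel = solve-∀

  norm²-actFin : ∀ w v → norm² v ≡ + 2 → norm² (actFin w v) ≡ + 2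
  norm²-actFin []      v ‖v‖²≡2 = ‖v‖²≡2
  norm²-actFin (i ∷ w) v ‖v‖²≡2 =
    trans (norm²-reflection (simple i) (actFin w v) (norm²-simple i)) (norm²-actFin w v ‖v‖²≡2)

  root⇒norm²≡2 : ∀ v → IsRoot v → norm² v ≡ + 2
  root⇒norm²≡2 v (w , i , v≈wαᵢ) = trans (norm²-cong v≈wαᵢ) (norm²-actFin w (simple i) (norm²-simple i))

  negQ : Q → Q
  negQ v i = - v i

  negQ≈combination : ∀ v → negQ v ≈ (λ i → -1ℤ * v i + 0ℤ * v i)
  negQ≈combination v i = as-combination (v i)
    where
    as-combination : ∀ x → - x ≡ -1ℤ * x + 0ℤ * x
    as-combination = solve-∀

  norm²-negQ : ∀ v → norm² (negQ v) ≡ norm² v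
  norm²-negQ v = begin
    norm² (negQ v)                                       ≡⟨ norm²-cong (negQ≈combination v) ⟩
    norm² (λ i → -1ℤ * v i + 0ℤ * v i)                   ≡⟨ bil-combination symmetric -1ℤ 0ℤ v v ⟩
    -1ℤ * -1ℤ * norm² v + + 2 * -1ℤ * 0ℤ * norm² v + 0ℤ * 0ℤ * norm² v ≡⟨ collapse (norm² v) ⟩
    norm² v                                              ∎
    where
    open ≡-Reasoning
    collapse : ∀ x → -1ℤ * -1ℤ * x + + 2 * -1ℤ * 0ℤ * x + 0ℤ * 0ℤ * x ≡ x
    collapse = solve-∀

  ⟪⟫-negˡ : ∀ u v → ⟪ negQ u , v ⟫ ≡ - ⟪ u , v ⟫
  ⟪⟫-negˡ u v = begin
    ⟪ negQ u , v ⟫                                 ≡⟨ bil-cong (negQ≈combination u) (λ _ → refl) ⟩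
    ⟪ (λ i → -1ℤ * u i + 0ℤ * u i) , v ⟫           ≡⟨ bil-linearˡ -1ℤ 0ℤ u u v ⟩
    -1ℤ * ⟪ u , v ⟫ + 0ℤ * ⟪ u , v ⟫               ≡⟨ collapse ⟪ u , v ⟫ ⟩
    - ⟪ u , v ⟫                                    ∎
    where
    open ≡-Reasoning
    collapse : ∀ x → -1ℤ * x + 0ℤ * x ≡ - x
    collapse = solve-∀

  ⟪⟫-negʳ : ∀ u v → ⟪ u , negQ v ⟫ ≡ - ⟪ u , v ⟫
  ⟪⟫-negʳ u v = trans (⟪⟫-sym u (negQ v)) (trans (⟪⟫-negˡ v u) (cong -_ (⟪⟫-sym v u)))

  dot-negʳ : ∀ (μ : P) v → dot μ (negQ v) ≡ - dot μ v
  dot-negʳ μ v = begin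
    sumℤ (λ i → μ i * - v i)        ≡⟨ sumℤ-cong (λ i → pull-sign (μ i) (v i)) ⟩
    sumℤ (λ i → -1ℤ * (μ i * v i))  ≡⟨ *-distribˡ-sumℤ -1ℤ (λ i → μ i * v i) ⟨
    -1ℤ * dot μ v                   ≡⟨ -1*i≡-i (dot μ v) ⟩
    - dot μ v                       ∎
    where
    open ≡-Reasoning
    pull-sign : ∀ x y → x * - y ≡ -1ℤ * (x * y)
    pull-sign = solve-∀

  ⟪⟫-disjoint-nonpos : (p q : Fin n → ℕ) → (∀ i → p i ℕ.* q i ≡ 0) →
    ⟪ (λ i → + p i) , (λ i → + q i) ⟫ ≤ 0ℤ
  ⟪⟫-disjoint-nonpos p q disjoint =
    subst (_≤ 0ℤ) (sumℤ-cong (λ i → sym (*-distribˡ-sumℤ (+ p i) (λ j → A i j * + q j))))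
      (sumℤ-nonpos _ (λ i → sumℤ-nonpos _ (term i)))
    where
    term : ∀ i j → + p i * (A i j * + q j) ≤ 0ℤ
    term i j with i Fin.≟ j
    ... | yes refl = ≤-reflexive (begin
      + p i * (A i i * + q i)    ≡⟨ reorder (+ p i) (A i i) (+ q i) ⟩
      A i i * (+ p i * + q i)    ≡⟨ cong (A i i *_) (pos-* (p i) (q i)) ⟨
      A i i * + (p i ℕ.* q i)    ≡⟨ cong (λ m → A i i * + m) (disjoint i) ⟩
      A i i * 0ℤ                 ≡⟨ *-zeroʳ (A i i) ⟩
      0ℤ                         ∎)
      where
      open ≡-Reasoning
      reorder : ∀ x a y → x * (a * y) ≡ a * (x * y)
      reorder = solve-∀
    ... | no i≢j with offDiagonal i j i≢j
    ... | inj₁ Aᵢⱼ≡0  = ≤-reflexive (trans (cong (λ a → + p i * (a * + q j)) Aᵢⱼ≡0) (*-zeroʳ (+ p i)))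
    ... | inj₂ Aᵢⱼ≡-1 =
      subst (_≤ 0ℤ) (sym (trans (cong (λ a → + p i * (a * + q j)) Aᵢⱼ≡-1) (negate (+ p i) (+ q j))))
            (neg-mono-≤ (subst (0ℤ ≤_) (pos-* (p i) (q j)) (+≤+ z≤n)))
      where
      negate : ∀ x y → x * (-1ℤ * y) ≡ - (x * y)
      negate = solve-∀

  two≤norm² : ∀ v → (∃ λ i → ¬ v i ≡ 0ℤ) → + 2 ≤ norm² v
  two≤norm² v v≢0 with bil-self-even A symmetric (λ i → 1ℤ , diagonal i) v
  ... | k , ‖v‖²≡k+k =
    subst (+ 2 ≤_) (sym ‖v‖²≡k+k) (positive⇒two≤double {k} (subst (0ℤ <_) ‖v‖²≡k+k (posDef v v≢0)))

  mixed-signs⇒4≤norm² : ∀ v → ¬ PosFin v → ¬ PosFin (negQ v) → + 4 ≤ norm² v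
  mixed-signs⇒4≤norm² v ¬v≥0 ¬v≤0 = subst (+ 4 ≤_) (sym expansion) lower-bound
    where
    v⁺ v⁻ : Q
    v⁺ i = + positivePart (v i)
    v⁻ i = + negativePart (v i)
    κ : ℤ
    κ = ⟪ v⁺ , v⁻ ⟫
    v≈combination : v ≈ (λ i → 1ℤ * v⁺ i + -1ℤ * v⁻ i)
    v≈combination i = trans (positivePart-negativePart (v i)) (as-combination (v⁺ i) (v⁻ i))
      where
      as-combination : ∀ x y → x - y ≡ 1ℤ * x + -1ℤ * y
      as-combination = solve-∀
    expansion : norm² v ≡ norm² v⁺ + norm² v⁻ + - (κ + κ)
    expansion = trans (norm²-cong v≈combination)
                  (trans (bil-combination symmetric 1ℤ -1ℤ v⁺ v⁻) (collect (norm² v⁺) κ (norm² v⁻)))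
      where
      collect : ∀ a x b → 1ℤ * 1ℤ * a + + 2 * 1ℤ * -1ℤ * x + -1ℤ * -1ℤ * b ≡ a + b + - (x + x)
      collect = solve-∀
    v⁺≢0 : ∃ λ i → ¬ v⁺ i ≡ 0ℤ
    v⁺≢0 with Fin.¬∀⟶∃¬ n _ (λ i → 0ℤ ≤? negQ v i) ¬v≤0
    ... | i , -vᵢ≱0 = i , positivePart≢0 -vᵢ≱0 ∘ cong ∣_∣
    v⁻≢0 : ∃ λ i → ¬ v⁻ i ≡ 0ℤ
    v⁻≢0 with Fin.¬∀⟶∃¬ n _ (λ i → 0ℤ ≤? v i) ¬v≥0
    ... | i , vᵢ≱0 = i , negativePart≢0 vᵢ≱0 ∘ cong ∣_∣
    -2κ≥0 : 0ℤ ≤ - (κ + κ)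
    -2κ≥0 = neg-mono-≤ (+-mono-≤ κ≤0 κ≤0)
      where
      κ≤0 : κ ≤ 0ℤ
      κ≤0 = ⟪⟫-disjoint-nonpos (positivePart ∘ v) (negativePart ∘ v) (λ i → positivePart*negativePart≡0 (v i))
    lower-bound : + 4 ≤ norm² v⁺ + norm² v⁻ + - (κ + κ)
    lower-bound = +-mono-≤ (+-mono-≤ (two≤norm² v⁺ v⁺≢0) (two≤norm² v⁻ v⁻≢0)) -2κ≥0

  nonneg⊎nonpos : ∀ v → norm² v ≡ + 2 → PosFin v ⊎ PosFin (negQ v)
  nonneg⊎nonpos v ‖v‖²≡2 with Fin.all? (λ i → 0ℤ ≤? v i) | Fin.all? (λ i → 0ℤ ≤? negQ v i)
  ... | yes v≥0 | _        = inj₁ v≥0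
  ... | no _    | yes v≤0  = inj₂ v≤0
  ... | no ¬v≥0 | no ¬v≤0  =
    contradiction (subst (+ 4 ≤_) ‖v‖²≡2 (mixed-signs⇒4≤norm² v ¬v≥0 ¬v≤0)) λ { (+≤+ (s≤s (s≤s ()))) }

  ¬nonneg×nonpos : ∀ v → norm² v ≡ + 2 → PosFin v → ¬ PosFin (negQ v)
  ¬nonneg×nonpos v ‖v‖²≡2 v≥0 v≤0 = contradiction (trans (sym ‖v‖²≡2) ‖v‖²≡0) λ ()
    where
    ‖v‖²≡0 : norm² v ≡ 0ℤ
    ‖v‖²≡0 = trans (norm²-cong (λ i → ≤-antisym (neg-cancel-≤ (v≤0 i)) (v≥0 i))) (sumℤ-zero n)

  -- Norm 2 is all the argument uses of "the finite part is a root".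
  Real : DAR → Set
  Real (ν , _ , _) = norm² ν ≡ + 2

  PosAff-dichotomy : ∀ ν r → norm² ν ≡ + 2 → PosAff (ν , r) ⊎ PosAff (negQ ν , - r)
  PosAff-dichotomy ν r ‖ν‖²≡2 with <-cmp 0ℤ r
  ... | tri< r>0 _ _ = inj₁ (inj₁ r>0)
  ... | tri> _ _ r<0 = inj₂ (inj₁ (neg-mono-< r<0))
  ... | tri≈ _ 0≡r _ with nonneg⊎nonpos ν ‖ν‖²≡2
  ... | inj₁ ν≥0 = inj₁ (inj₂ (sym 0≡r , ν≥0))
  ... | inj₂ ν≤0 = inj₂ (inj₂ (cong -_ (sym 0≡r) , ν≤0))

  PosAff-exclusive : ∀ ν r → norm² ν ≡ + 2 → PosAff (ν , r) → ¬ PosAff (negQ ν , - r)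
  PosAff-exclusive ν r _       (inj₁ r>0)       (inj₁ -r>0)       = <-asym r>0 (neg-cancel-< -r>0)
  PosAff-exclusive ν r _       (inj₁ r>0)       (inj₂ (-r≡0 , _)) = <-irrefl (sym (neg-zero⇒zero -r≡0)) r>0
    where
    neg-zero⇒zero : - r ≡ 0ℤ → r ≡ 0ℤ
    neg-zero⇒zero -r≡0 = trans (sym (neg-involutive r)) (cong -_ -r≡0)
  PosAff-exclusive ν r _       (inj₂ (r≡0 , _)) (inj₁ -r>0)       = <-irrefl (sym (cong -_ r≡0)) -r>0
  PosAff-exclusive ν r ‖ν‖²≡2 (inj₂ (_ , ν≥0)) (inj₂ (_ , ν≤0))   = ¬nonneg×nonpos ν ‖ν‖²≡2 ν≥0 ν≤0

  NegD⇔PosD-negD : ∀ β → Real β → NegD β ⇔ PosD (negD β)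
  NegD⇔PosD-negD (ν , r , j) ‖ν‖²≡2 = mk⇔ to from
    where
    to : NegD (ν , r , j) → PosD (negD (ν , r , j))
    to β≯0 with PosAff-dichotomy ν r ‖ν‖²≡2 | 0ℤ ≤? j
    ... | inj₁ ν+rδ>0  | yes j≥0 = contradiction (inj₁ (ν+rδ>0 , j≥0)) β≯0
    ... | inj₁ ν+rδ>0  | no j≱0  = inj₂ (PosAff-exclusive ν r ‖ν‖²≡2 ν+rδ>0 , neg-mono-< (≰⇒> j≱0))
    ... | inj₂ -ν-rδ>0 | yes j≥0 with 0ℤ ≤? - j
    ...   | yes -j≥0 = inj₁ (-ν-rδ>0 , -j≥0)
    ...   | no -j≱0  = contradiction (inj₂ (ν+rδ≯0 , neg-cancel-< (≰⇒> -j≱0))) β≯0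
      where
      ν+rδ≯0 : ¬ PosAff (ν , r)
      ν+rδ≯0 ν+rδ>0 = PosAff-exclusive ν r ‖ν‖²≡2 ν+rδ>0 -ν-rδ>0
    to β≯0 | inj₂ -ν-rδ>0 | no j≱0 = inj₁ (-ν-rδ>0 , <⇒≤ (neg-mono-< (≰⇒> j≱0)))
    from : PosD (negD (ν , r , j)) → NegD (ν , r , j)
    from (inj₁ (-ν-rδ>0 , _))  (inj₁ (ν+rδ>0 , _)) = PosAff-exclusive ν r ‖ν‖²≡2 ν+rδ>0 -ν-rδ>0
    from (inj₁ (_ , -j≥0))     (inj₂ (_ , j>0))    = ≤⇒≯ -j≥0 (neg-mono-< j>0)
    from (inj₂ (_ , -j>0))     (inj₁ (_ , j≥0))    = ≤⇒≯ (neg-mono-≤ j≥0) -j>0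
    from (inj₂ (_ , -j>0))     (inj₂ (_ , j>0))    = <-asym (neg-mono-< j>0) -j>0

  infix 4 _≈D_
  _≈D_ : DAR → DAR → Set
  (ν , r , j) ≈D (ν′ , r′ , j′) = ν ≈ ν′ × r ≡ r′ × j ≡ j′

  ≈D-sym : ∀ {β β′} → β ≈D β′ → β′ ≈D β
  ≈D-sym (ν≈ν′ , r≡r′ , j≡j′) = sym ∘ ν≈ν′ , sym r≡r′ , sym j≡j′

  ≈D-trans : ∀ {β β′ β″} → β ≈D β′ → β′ ≈D β″ → β ≈D β″
  ≈D-trans (ν≈ν′ , r≡r′ , j≡j′) (ν′≈ν″ , r′≡r″ , j′≡j″) =
    (λ i → trans (ν≈ν′ i) (ν′≈ν″ i)) , trans r≡r′ r′≡r″ , trans j≡j′ j′≡j″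

  negD-involutive : ∀ β → negD (negD β) ≈D β
  negD-involutive (ν , r , j) = (λ i → neg-involutive (ν i)) , neg-involutive r , neg-involutive j

  PosAff-resp : ∀ {ν ν′ r r′} → ν ≈ ν′ → r ≡ r′ → PosAff (ν , r) → PosAff (ν′ , r′)
  PosAff-resp ν≈ν′ refl (inj₁ r>0)         = inj₁ r>0
  PosAff-resp ν≈ν′ refl (inj₂ (r≡0 , ν≥0)) = inj₂ (r≡0 , λ i → subst (0ℤ ≤_) (ν≈ν′ i) (ν≥0 i))

  PosD-resp : ∀ {β β′} → β ≈D β′ → PosD β → PosD β′
  PosD-resp (ν≈ν′ , r≡r′ , refl) (inj₁ (ν+rδ>0 , j≥0)) = inj₁ (PosAff-resp ν≈ν′ r≡r′ ν+rδ>0 , j≥0)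
  PosD-resp (ν≈ν′ , r≡r′ , refl) (inj₂ (ν+rδ≯0 , j>0)) =
    inj₂ (ν+rδ≯0 ∘ PosAff-resp (sym ∘ ν≈ν′) (sym r≡r′) , j>0)

  NegD-resp : ∀ {β β′} → β ≈D β′ → NegD β → NegD β′
  NegD-resp β≈β′ β≯0 = β≯0 ∘ PosD-resp (≈D-sym β≈β′)

  ⟪⟫-congʳ : ∀ u {v v′} → v ≈ v′ → ⟪ u , v ⟫ ≡ ⟪ u , v′ ⟫
  ⟪⟫-congʳ u = bil-cong {u = u} {u′ = u} (λ _ → refl)

  refl'-resp : ∀ ν {v v′} → v ≈ v′ → refl' ν v ≈ refl' ν v′
  refl'-resp ν v≈v′ i = cong₂ (λ a c → a - c * ν i) (v≈v′ i) (bil-cong v≈v′ (λ _ → refl))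

  refl'-negQ : ∀ ν v → refl' ν (negQ v) ≈ negQ (refl' ν v)
  refl'-negQ ν v i = trans (cong (λ c → - v i - c * ν i) (⟪⟫-negˡ v ν)) (pull-sign (v i) ⟪ v , ν ⟫ (ν i))
    where
    pull-sign : ∀ a c x → - a - - c * x ≡ - (a - c * x)
    pull-sign = solve-∀

  actFin-resp : ∀ w {v v′} → v ≈ v′ → actFin w v ≈ actFin w v′
  actFin-resp []      v≈v′ = v≈v′
  actFin-resp (i ∷ w) v≈v′ = refl'-resp (simple i) (actFin-resp w v≈v′)

  actFin-negQ : ∀ w v → actFin w (negQ v) ≈ negQ (actFin w v)
  actFin-negQ []      v i = refl
  actFin-negQ (k ∷ w) v i =
    trans (refl'-resp (simple k) (actFin-negQ w v) i) (refl'-negQ (simple k) (actFin w v) i)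

  actD-resp : ∀ g {β β′} → β ≈D β′ → actD g β ≈D actD g β′
  actD-resp (xw (mkX μ _ l) λY w) {ν , r , j} {ν′ , _ , _} (ν≈ν′ , refl , refl) =
    wν≈wν′ , r-cong , cong₂ (λ d s → j - (d + l * s)) (sumℤ-cong (λ i → cong (μ i *_) (wν≈wν′ i))) r-cong
    where
    wν≈wν′ : actFin w ν ≈ actFin w ν′
    wν≈wν′ = actFin-resp w ν≈ν′
    r-cong : r - ⟪ λY , actFin w ν ⟫ ≡ r - ⟪ λY , actFin w ν′ ⟫
    r-cong = cong (λ c → r - c) (⟪⟫-congʳ λY wν≈wν′)

  actD-negD : ∀ g β → actD g (negD β) ≈D negD (actD g β)
  actD-negD (xw (mkX μ _ l) λY w) (ν , r , j) = wν-neg , r-neg , j-neg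
    where
    ν′ : Q
    ν′ = actFin w ν
    r′ : ℤ
    r′ = r - ⟪ λY , ν′ ⟫
    wν-neg : actFin w (negQ ν) ≈ negQ ν′
    wν-neg = actFin-negQ w ν
    r-neg : - r - ⟪ λY , actFin w (negQ ν) ⟫ ≡ - r′
    r-neg = begin
      - r - ⟪ λY , actFin w (negQ ν) ⟫  ≡⟨ cong (λ c → - r - c) (⟪⟫-congʳ λY wν-neg) ⟩
      - r - ⟪ λY , negQ ν′ ⟫            ≡⟨ cong (λ c → - r - c) (⟪⟫-negʳ λY ν′) ⟩
      - r - - ⟪ λY , ν′ ⟫               ≡⟨ pull-sign r ⟪ λY , ν′ ⟫ ⟩
      - r′                              ∎
      where
      open ≡-Reasoning
      pull-sign : ∀ a c → - a - - c ≡ - (a - c)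
      pull-sign = solve-∀
    j-neg : - j - (dot μ (actFin w (negQ ν)) + l * (- r - ⟪ λY , actFin w (negQ ν) ⟫))
          ≡ - (j - (dot μ ν′ + l * r′))
    j-neg = begin
      - j - (dot μ (actFin w (negQ ν)) + l * (- r - ⟪ λY , actFin w (negQ ν) ⟫))
        ≡⟨ cong₂ (λ d s → - j - (d + l * s)) (sumℤ-cong (λ i → cong (μ i *_) (wν-neg i))) r-neg ⟩
      - j - (dot μ (negQ ν′) + l * - r′)   ≡⟨ cong (λ d → - j - (d + l * - r′)) (dot-negʳ μ ν′) ⟩
      - j - (- dot μ ν′ + l * - r′)        ≡⟨ pull-sign j (dot μ ν′) l r′ ⟩
      - (j - (dot μ ν′ + l * r′))          ∎
      where
      open ≡-Reasoning
      pull-sign : ∀ a d l s → - a - (- d + l * - s) ≡ - (a - (d + l * s))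
      pull-sign = solve-∀

  actInv-negD : ∀ x β → actInv x (negD β) ≈D negD (actInv x β)
  actInv-negD (xw ζ λY w) β =
    ≈D-trans (actD-resp g₃ (≈D-trans (actD-resp g₂ (actD-negD g₁ β)) (actD-negD g₂ (actD g₁ β))))
             (actD-negD g₃ (actD g₂ (actD g₁ β)))
    where
    g₁ g₂ g₃ : XW
    g₁ = xw (negX ζ) (λ _ → 0ℤ) []
    g₂ = xw zeroX (λ i → - λY i) []
    g₃ = xw zeroX (λ _ → 0ℤ) (reverse w)

  Real-negD : ∀ β → Real β → Real (negD β)
  Real-negD (ν , _ , _) ‖ν‖²≡2 = trans (norm²-negQ ν) ‖ν‖²≡2

  Real-actInv : ∀ x β → Real β → Real (actInv x β)
  Real-actInv (xw _ _ w) (ν , _ , _) = norm²-actFin (reverse w) ν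

  Real-sD : ∀ α β → Real α → Real β → Real (sD α β)
  Real-sD (ν , _ , _) (γ , _ , _) ‖ν‖²≡2 ‖γ‖²≡2 = trans (norm²-reflection ν γ ‖ν‖²≡2) ‖γ‖²≡2

  PosD-actInv⇔NegD-actInv-negD : ∀ x β → Real β → PosD (actInv x β) ⇔ NegD (actInv x (negD β))
  PosD-actInv⇔NegD-actInv-negD x β real-β = mk⇔ to from
    where
    t : DAR
    t = actInv x β
    -t⁻⇔ : NegD (negD t) ⇔ PosD (negD (negD t))
    -t⁻⇔ = NegD⇔PosD-negD (negD t) (Real-negD t (Real-actInv x β real-β))
    to : PosD t → NegD (actInv x (negD β))
    to t>0 = NegD-resp (≈D-sym (actInv-negD x β))
               (Equivalence.from -t⁻⇔ (PosD-resp (≈D-sym (negD-involutive t)) t>0))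
    from : NegD (actInv x (negD β)) → PosD t
    from x⁻¹-β≯0 = PosD-resp (negD-involutive t)
                     (Equivalence.to -t⁻⇔ (NegD-resp (actInv-negD x β) x⁻¹-β≯0))

mainTheorem5 : (n : ℕ) (C : SimplyLacedCartan n) →
    let open Setup C in
    (x : W) → 0ℤ < levW x →
    (α : DAR) → IsRoot (proj₁ α) →
    (γ : Q) (p q : ℤ) → IsRoot γ →
    let β = γ , p , q in
    let γ' = proj₁ (negD (sD α β)) in
    let p' = proj₁ (proj₂ (negD (sD α β))) in
    let q' = proj₂ (proj₂ (negD (sD α β))) in
    L x α β ⇔ (Γ x γ (p , q) × Γ x γ' (p' , q'))
mainTheorem5 n C x _ α α-root γ p q γ-root = mk⇔
  (λ (β>0 , x⁻¹β≯0 , sβ≯0 , x⁻¹sβ>0) → (β>0 , x⁻¹β≯0) , to -sβ⇔ sβ≯0 , to x⁻¹sβ⇔ x⁻¹sβ>0)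
  (λ ((β>0 , x⁻¹β≯0) , -sβ>0 , x⁻¹-sβ≯0) → β>0 , x⁻¹β≯0 , from -sβ⇔ -sβ>0 , from x⁻¹sβ⇔ x⁻¹-sβ≯0)
  where
  open Setup C
  open RootSystem C
  open Equivalence
  sβ : DAR
  sβ = sD α (γ , p , q)
  real-sβ : Real sβ
  real-sβ = Real-sD α (γ , p , q) (root⇒norm²≡2 (proj₁ α) α-root) (root⇒norm²≡2 γ γ-root)
  -sβ⇔ : NegD sβ ⇔ PosD (negD sβ)
  -sβ⇔ = NegD⇔PosD-negD sβ real-sβ
  x⁻¹sβ⇔ : PosD (actInv (W.elt x) sβ) ⇔ NegD (actInv (W.elt x) (negD sβ))
  x⁻¹sβ⇔ = PosD-actInv⇔NegD-actInv-negD (W.elt x) sβ real-sβ
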